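{- Let $F_3:\mathbf{Sets}\times\mathbf{Sets}\to\mathbf{Sets}\times\mathbf{Sets}$ be given by $F_3(N,E)=(1,(N\uplus E)\times(N\uplus E))$ and $F_3(f_N,f_E)=(\mathrm{id}_1,(f_N\uplus f_E)\times(f_N\uplus f_E))$, and let $\mathcal{M}$ be the class of morphisms $(f_N,f_E)$ of $\mathbf{Coalg}_{F_3}$ with both components injective. Then $(\mathbf{Coalg}_{F_3},\mathcal{M})$ is an $\mathcal{M}$-adhesive category.
   Context: $1$ is a one-element set and $\uplus$ disjoint union. An object of $\mathbf{Coalg}_{F_3}$ (a graph with nested directed edges) is a pair of sets $(N,E)$ with the unique map $N\to 1$ and a function $c:E\to(N\uplus E)\times(N\uplus E)$ (source and target, each a node or an edge); morphisms are pairs $(f_N,f_E)$ with $((f_N\uplus f_E)\times(f_N\uplus f_E))\circ c_1=c_2\circ f_E$. For a category $\mathcal{C}$ and class $\mathcal{M}$ of monomorphisms, $(\mathcal{C},\mathcal{M})$ is $\mathcal{M}$-adhesive if $\mathcal{M}$ contains all identities and is closed under composition; pushouts and pullbacks along $\mathcal{M}$-morphisms exist and $\mathcal{M}$ is stable under both; and pushouts along $\mathcal{M}$-morphisms are vertical weak van Kampen squares (for every commutative cube with such a pushout as bottom face, all vertical morphisms in $\mathcal{M}$ and back faces pullbacks, the top face is a pushout iff the front faces are pullbacks). -}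

module Defs where

-- Category Coalg_{F3} over "Sets", where Sets is modelled constructively
-- by setoids (carrier + equivalence relation), and morphism equality is
-- pointwise setoid equality.

open import Level using (Level; suc; _⊔_)
open import Relation.Binary.Bundles using (Setoid)
open import Function.Bundles using (Func)
open import Data.Sum.Base using (_⊎_; inj₁; inj₂)
open import Data.Product.Base using (Σ; _×_; _,_; proj₁; proj₂)
open import Data.Sum.Relation.Binary.Pointwise using (_⊎ₛ_; inj₁; inj₂)
open import Data.Product.Relation.Binary.Pointwise.NonDependent using (_×ₛ_)
open import Data.Sum.Function.Setoid using (_⊎-function_)
open import Data.Product.Function.NonDependent.Setoid using (_×-function_)

open Func

-- the E-component of F3 on objects: (N ⊎ E) × (N ⊎ E)
F₃ : ∀ {ℓ} → Setoid ℓ ℓ → Setoid ℓ ℓ → Setoid ℓ ℓ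
F₃ N E = (N ⊎ₛ E) ×ₛ (N ⊎ₛ E)

F₃map : ∀ {ℓ} {N₁ E₁ N₂ E₂ : Setoid ℓ ℓ} →
        Func N₁ N₂ → Func E₁ E₂ → Func (F₃ N₁ E₁) (F₃ N₂ E₂)
F₃map fN fE = (fN ⊎-function fE) ×-function (fN ⊎-function fE)

-- An F3-coalgebra: node set N, edge set E, and c : E → (N ⊎ E) × (N ⊎ E).
-- (The N-component N → 1 is unique, so it carries no data.)
record Coalg (ℓ : Level) : Set (suc ℓ) where
  field
    N : Setoid ℓ ℓ
    E : Setoid ℓ ℓ
    c : Func E (F₃ N E)

open Coalg public

record Hom {ℓ} (X Y : Coalg ℓ) : Set ℓ where
  field
    fN : Func (N X) (N Y)
    fE : Func (E X) (E Y)
    comm : ∀ e → Setoid._≈_ (F₃ (N Y) (E Y))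
                   (to (F₃map fN fE) (to (c X) e))
                   (to (c Y) (to fE e))

open Hom public

_≋_ : ∀ {ℓ} {X Y : Coalg ℓ} → Hom X Y → Hom X Y → Set ℓ
_≋_ {Y = Y} f g =
  (∀ n → Setoid._≈_ (N Y) (to (fN f) n) (to (fN g) n)) ×
  (∀ e → Setoid._≈_ (E Y) (to (fE f) e) (to (fE g) e))

infix 4 _≋_

idFunc : ∀ {ℓ} (S : Setoid ℓ ℓ) → Func S S
idFunc S = record { to = λ x → x ; cong = λ p → p }

_∘F_ : ∀ {ℓ} {A B C : Setoid ℓ ℓ} → Func B C → Func A B → Func A C
g ∘F f = record { to = λ x → to g (to f x) ; cong = λ p → cong g (cong f p) }

private
  idF₃ : ∀ {ℓ} (N E : Setoid ℓ ℓ) (x : Setoid.Carrier (F₃ N E)) →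
         Setoid._≈_ (F₃ N E) (to (F₃map (idFunc N) (idFunc E)) x) x
  idF₃ N E (inj₁ a , inj₁ b) = inj₁ (Setoid.refl N) , inj₁ (Setoid.refl N)
  idF₃ N E (inj₁ a , inj₂ b) = inj₁ (Setoid.refl N) , inj₂ (Setoid.refl E)
  idF₃ N E (inj₂ a , inj₁ b) = inj₂ (Setoid.refl E) , inj₁ (Setoid.refl N)
  idF₃ N E (inj₂ a , inj₂ b) = inj₂ (Setoid.refl E) , inj₂ (Setoid.refl E)

  compF₃ : ∀ {ℓ} {N₁ E₁ N₂ E₂ N₃ E₃ : Setoid ℓ ℓ}
           (gN : Func N₂ N₃) (gE : Func E₂ E₃) (fN : Func N₁ N₂) (fE : Func E₁ E₂)
           (x : Setoid.Carrier (F₃ N₁ E₁)) →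
           Setoid._≈_ (F₃ N₃ E₃) (to (F₃map (gN ∘F fN) (gE ∘F fE)) x)
                                  (to (F₃map gN gE) (to (F₃map fN fE) x))
  compF₃ {N₃ = N₃} {E₃ = E₃} gN gE fN fE (inj₁ a , inj₁ b) = inj₁ (Setoid.refl N₃) , inj₁ (Setoid.refl N₃)
  compF₃ {N₃ = N₃} {E₃ = E₃} gN gE fN fE (inj₁ a , inj₂ b) = inj₁ (Setoid.refl N₃) , inj₂ (Setoid.refl E₃)
  compF₃ {N₃ = N₃} {E₃ = E₃} gN gE fN fE (inj₂ a , inj₁ b) = inj₂ (Setoid.refl E₃) , inj₁ (Setoid.refl N₃)
  compF₃ {N₃ = N₃} {E₃ = E₃} gN gE fN fE (inj₂ a , inj₂ b) = inj₂ (Setoid.refl E₃) , inj₂ (Setoid.refl E₃)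

idH : ∀ {ℓ} (X : Coalg ℓ) → Hom X X
idH X = record
  { fN = idFunc (N X)
  ; fE = idFunc (E X)
  ; comm = λ e → idF₃ (N X) (E X) (to (c X) e)
  }

_∘H_ : ∀ {ℓ} {X Y Z : Coalg ℓ} → Hom Y Z → Hom X Y → Hom X Z
_∘H_ {X = X} {Y} {Z} g f = record
  { fN = fN g ∘F fN f
  ; fE = fE g ∘F fE f
  ; comm = λ e → Setoid.trans (F₃ (N Z) (E Z))
                   (compF₃ (fN g) (fE g) (fN f) (fE f) (to (c X) e))
                   (Setoid.trans (F₃ (N Z) (E Z))
                     (cong (F₃map (fN g) (fE g)) (comm f e))
                     (comm g (to (fE f) e)))
  }

infixr 9 _∘H_

Injective : ∀ {ℓ} {A B : Setoid ℓ ℓ} → Func A B → Set ℓ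
Injective {A = A} {B} f =
  ∀ {x y} → Setoid._≈_ B (to f x) (to f y) → Setoid._≈_ A x y

M : ∀ {ℓ} {X Y : Coalg ℓ} → Hom X Y → Set ℓ
M f = Injective (fN f) × Injective (fE f)

Mono : ∀ {ℓ} {X Y : Coalg ℓ} → Hom X Y → Set (suc ℓ)
Mono {ℓ} {X} m = ∀ (W : Coalg ℓ) (g h : Hom W X) → m ∘H g ≋ m ∘H h → g ≋ h

-- Squares
--     A --f--> B
--     |        |
--     g        i₁
--     v        v
--     C --i₂-> D
IsPushout : ∀ {ℓ} {A B C D : Coalg ℓ} →
            Hom A B → Hom A C → Hom B D → Hom C D → Set (suc ℓ)
IsPushout {ℓ} {A} {B} {C} {D} f g i₁ i₂ =
  (i₁ ∘H f ≋ i₂ ∘H g) ×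
  (∀ (X : Coalg ℓ) (h₁ : Hom B X) (h₂ : Hom C X) → h₁ ∘H f ≋ h₂ ∘H g →
     Σ (Hom D X) λ u → (u ∘H i₁ ≋ h₁) × (u ∘H i₂ ≋ h₂) ×
       (∀ (u' : Hom D X) → u' ∘H i₁ ≋ h₁ → u' ∘H i₂ ≋ h₂ → u' ≋ u))

IsPullback : ∀ {ℓ} {A B C D : Coalg ℓ} →
             Hom A B → Hom A C → Hom B D → Hom C D → Set (suc ℓ)
IsPullback {ℓ} {A} {B} {C} {D} p₁ p₂ f g =
  (f ∘H p₁ ≋ g ∘H p₂) ×
  (∀ (X : Coalg ℓ) (h₁ : Hom X B) (h₂ : Hom X C) → f ∘H h₁ ≋ g ∘H h₂ →
     Σ (Hom X A) λ u → (p₁ ∘H u ≋ h₁) × (p₂ ∘H u ≋ h₂) ×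
       (∀ (u' : Hom X A) → p₁ ∘H u' ≋ h₁ → p₂ ∘H u' ≋ h₂ → u' ≋ u))

_⇔_ : ∀ {a b} → Set a → Set b → Set (a ⊔ b)
P ⇔ Q = (P → Q) × (Q → P)

VerticalWeakVK : ∀ {ℓ} {A B C D : Coalg ℓ} →
                 Hom A B → Hom A C → Hom B D → Hom C D → Set (suc ℓ)
VerticalWeakVK {ℓ} {A} {B} {C} {D} m f g n =
  ∀ (A' B' C' D' : Coalg ℓ)
    (m' : Hom A' B') (f' : Hom A' C') (g' : Hom B' D') (n' : Hom C' D')
    (a : Hom A' A) (b : Hom B' B) (cc : Hom C' C) (d : Hom D' D) →
  g' ∘H m' ≋ n' ∘H f' →
  m ∘H a ≋ b ∘H m' →
  f ∘H a ≋ cc ∘H f' →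
  g ∘H b ≋ d ∘H g' →
  n ∘H cc ≋ d ∘H n' →
  M a → M b → M cc → M d →
  IsPullback m' a b m →
  IsPullback f' a cc f →
  IsPushout m' f' g' n' ⇔ (IsPullback g' b d g × IsPullback n' cc d n)

record IsMAdhesive (ℓ : Level) : Set (suc ℓ) where
  field
    M-mono : ∀ {X Y : Coalg ℓ} (f : Hom X Y) → M f → Mono f
    M-id   : ∀ (X : Coalg ℓ) → M (idH X)
    M-comp : ∀ {X Y Z : Coalg ℓ} (g : Hom Y Z) (f : Hom X Y) →
             M f → M g → M (g ∘H f)
    pushout : ∀ {A B C : Coalg ℓ} (m : Hom A B) (f : Hom A C) → M m →
              Σ (Coalg ℓ) λ D → Σ (Hom B D) λ g → Σ (Hom C D) λ n →
                IsPushout m f g n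
    pullback : ∀ {B C D : Coalg ℓ} (g : Hom B D) (n : Hom C D) → M n →
               Σ (Coalg ℓ) λ A → Σ (Hom A B) λ p₁ → Σ (Hom A C) λ p₂ →
                 IsPullback p₁ p₂ g n
    M-pushout-stable : ∀ {A B C D : Coalg ℓ}
                       (m : Hom A B) (f : Hom A C) (g : Hom B D) (n : Hom C D) →
                       M m → IsPushout m f g n → M n
    M-pullback-stable : ∀ {A B C D : Coalg ℓ}
                        (p₁ : Hom A B) (p₂ : Hom A C) (g : Hom B D) (n : Hom C D) →
                        M n → IsPullback p₁ p₂ g n → M p₁
    vanKampen : ∀ {A B C D : Coalg ℓ}
                (m : Hom A B) (f : Hom A C) (g : Hom B D) (n : Hom C D) →
                M m → IsPushout m f g n → VerticalWeakVK m f g n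

module Submission where

-- Everything is reduced to setoids, one component (nodes, edges) at a time.
-- We describe elementwise when a commuting square of setoids is a pullback
-- (`PullbackSquare`) and when a square along an injection is a pushout
-- (`PushoutSquare`: the pushout of sets along a mono glues only images of
-- points with equal image on the other side), prove their universal properties
-- and their invariance under retracts, construct both in setoids (a quotient of
-- B ⊎ C, a subsetoid of B × C), and show that F₃ preserves pullback squares.
-- Lifting to coalgebras, a square that is componentwise elementwise is a
-- pushout/pullback in Coalg_{F₃}; such squares exist; and, by comparison with
-- the constructed ones, every pushout along M and every pullback is
-- componentwise elementwise. The van Kampen property then becomes a statement
-- about a cube of setoids, proved elementwise and applied to both components.
-- The M-adhesivity axioms follow: stability of M holds because the side of a
-- pushout opposite an injection is injective and pullbacks reflect injectivity.

open import Defs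
open import Level using (Level)
open import Relation.Binary.Bundles using (Setoid)
open import Function.Bundles using (Func)
open import Data.Sum.Base using (_⊎_; inj₁; inj₂; [_,_]′)
open import Data.Product.Base using (Σ; _×_; _,_; proj₁; proj₂)
open import Data.Sum.Relation.Binary.Pointwise using (_⊎ₛ_; inj₁; inj₂)
open import Data.Sum.Function.Setoid using (_⊎-function_)
open import Data.Product.Function.NonDependent.Setoid using (_×-function_)
import Relation.Binary.Reasoning.Setoid as SetoidReasoning

open Func

module _ {ℓ : Level} where

  variable
    A B C D X A' B' C' D' : Setoid ℓ ℓ

  ∣_∣ : Setoid ℓ ℓ → Set ℓ
  ∣ S ∣ = Setoid.Carrier S

  _[_≈_] : (S : Setoid ℓ ℓ) → ∣ S ∣ → ∣ S ∣ → Set ℓ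
  S [ x ≈ y ] = Setoid._≈_ S x y

  refl[_] : (S : Setoid ℓ ℓ) {x : ∣ S ∣} → S [ x ≈ x ]
  refl[ S ] = Setoid.refl S

  sym[_] : (S : Setoid ℓ ℓ) {x y : ∣ S ∣} → S [ x ≈ y ] → S [ y ≈ x ]
  sym[ S ] = Setoid.sym S

  trans[_] : (S : Setoid ℓ ℓ) {x y z : ∣ S ∣} → S [ x ≈ y ] → S [ y ≈ z ] → S [ x ≈ z ]
  trans[ S ] = Setoid.trans S

  via[_] : (S : Setoid ℓ ℓ) {x x' y' y : ∣ S ∣} →
           S [ x' ≈ x ] → S [ x' ≈ y' ] → S [ y' ≈ y ] → S [ x ≈ y ]
  via[ S ] p e q = trans[ S ] (sym[ S ] p) (trans[ S ] e q)

  Commutes : Func A B → Func A C → Func B D → Func C D → Set ℓ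
  Commutes {D = D} m f g n = ∀ a → D [ to g (to m a) ≈ to n (to f a) ]

  -- Elementwise pullbacks of setoids

  record PullbackSquare (p₁ : Func A B) (p₂ : Func A C) (f : Func B D) (g : Func C D) : Set ℓ where
    field
      pb-commutes : Commutes p₁ p₂ f g
      pb-gap : ∀ {b c} → D [ to f b ≈ to g c ] →
               Σ ∣ A ∣ λ x → B [ to p₁ x ≈ b ] × C [ to p₂ x ≈ c ]
      pb-jointly-injective : ∀ {x y} → B [ to p₁ x ≈ to p₁ y ] → C [ to p₂ x ≈ to p₂ y ] → A [ x ≈ y ]

  open PullbackSquare public

  pair : {p₁ : Func A B} {p₂ : Func A C} {f : Func B D} {g : Func C D} →
         PullbackSquare p₁ p₂ f g → (h₁ : Func X B) (h₂ : Func X C) → Commutes h₁ h₂ f g →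
         Σ (Func X A) λ u → (∀ x → B [ to p₁ (to u x) ≈ to h₁ x ]) × (∀ x → C [ to p₂ (to u x) ≈ to h₂ x ])
  pair {A = A} {B = B} {C = C} {X = X} {p₁ = p₁} {p₂} sq h₁ h₂ h-commutes = u , over-h₁ , over-h₂
    where
    over-h₁ : ∀ x → B [ to p₁ (proj₁ (pb-gap sq (h-commutes x))) ≈ to h₁ x ]
    over-h₁ x = proj₁ (proj₂ (pb-gap sq (h-commutes x)))

    over-h₂ : ∀ x → C [ to p₂ (proj₁ (pb-gap sq (h-commutes x))) ≈ to h₂ x ]
    over-h₂ x = proj₂ (proj₂ (pb-gap sq (h-commutes x)))

    u : Func X A
    u = record
      { to = λ x → proj₁ (pb-gap sq (h-commutes x))
      ; cong = λ {x} {y} e → pb-jointly-injective sq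
          (trans[ B ] (over-h₁ x) (trans[ B ] (cong h₁ e) (sym[ B ] (over-h₁ y))))
          (trans[ C ] (over-h₂ x) (trans[ C ] (cong h₂ e) (sym[ C ] (over-h₂ y)))) }

  pullback-reflects-injective : {p₁ : Func A B} {p₂ : Func A C} {f : Func B D} {g : Func C D} →
                                PullbackSquare p₁ p₂ f g → Injective g → Injective p₁
  pullback-reflects-injective {D = D} {f = f} sq g-injective {x} {y} e =
    pb-jointly-injective sq e
      (g-injective (via[ D ] (pb-commutes sq x) (cong f e) (pb-commutes sq y)))

  pullback-transport : {p₁ : Func A B} {p₂ : Func A C} {f : Func B D} {g : Func C D}
                       {q₁ : Func X B} {q₂ : Func X C} → PullbackSquare q₁ q₂ f g →
                       Commutes p₁ p₂ f g → (u : Func X A) (k : Func A X) →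
                       (∀ x → B [ to p₁ (to u x) ≈ to q₁ x ]) → (∀ x → C [ to p₂ (to u x) ≈ to q₂ x ]) →
                       (∀ a → B [ to q₁ (to k a) ≈ to p₁ a ]) → (∀ a → C [ to q₂ (to k a) ≈ to p₂ a ]) →
                       (∀ a → A [ to u (to k a) ≈ a ]) → PullbackSquare p₁ p₂ f g
  pullback-transport {A = A} {B} {C} sq p-commutes u k u₁ u₂ k₁ k₂ uk = record
    { pb-commutes = p-commutes
    ; pb-gap = λ e → let (x , r₁ , r₂) = pb-gap sq e in
                     to u x , trans[ B ] (u₁ x) r₁ , trans[ C ] (u₂ x) r₂
    ; pb-jointly-injective = λ {a} {a'} p q →
        via[ A ] (uk a)
          (cong u (pb-jointly-injective sq (trans[ B ] (k₁ a) (trans[ B ] p (sym[ B ] (k₁ a'))))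
                                        (trans[ C ] (k₂ a) (trans[ C ] q (sym[ C ] (k₂ a'))))))
          (uk a') }

  pullback-⊎ : {p₁ : Func A B} {p₂ : Func A C} {f : Func B D} {g : Func C D}
               {p₁' : Func A' B'} {p₂' : Func A' C'} {f' : Func B' D'} {g' : Func C' D'} →
               PullbackSquare p₁ p₂ f g → PullbackSquare p₁' p₂' f' g' →
               PullbackSquare (p₁ ⊎-function p₁') (p₂ ⊎-function p₂') (f ⊎-function f') (g ⊎-function g')
  pullback-⊎ {A = A} {B} {C} {D} {A'} {B'} {C'} {D'} {p₁} {p₂} {f} {g} {p₁'} {p₂'} {f'} {g'} sq sq' = record
    { pb-commutes = λ { (inj₁ a) → inj₁ (pb-commutes sq a) ; (inj₂ a) → inj₂ (pb-commutes sq' a) }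
    ; pb-gap = gap
    ; pb-jointly-injective = jointly-injective }
    where
    q₁ : Func (A ⊎ₛ A') (B ⊎ₛ B')
    q₁ = p₁ ⊎-function p₁'

    q₂ : Func (A ⊎ₛ A') (C ⊎ₛ C')
    q₂ = p₂ ⊎-function p₂'

    gap : ∀ {b c} → (D ⊎ₛ D') [ to (f ⊎-function f') b ≈ to (g ⊎-function g') c ] →
          Σ ∣ A ⊎ₛ A' ∣ λ x → (B ⊎ₛ B') [ to q₁ x ≈ b ] × (C ⊎ₛ C') [ to q₂ x ≈ c ]
    gap {inj₁ b} {inj₁ c} (inj₁ e) = let (a , p , q) = pb-gap sq e in inj₁ a , inj₁ p , inj₁ q
    gap {inj₂ b} {inj₂ c} (inj₂ e) = let (a , p , q) = pb-gap sq' e in inj₂ a , inj₂ p , inj₂ q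

    jointly-injective : ∀ {x y} → (B ⊎ₛ B') [ to q₁ x ≈ to q₁ y ] → (C ⊎ₛ C') [ to q₂ x ≈ to q₂ y ] →
                        (A ⊎ₛ A') [ x ≈ y ]
    jointly-injective {inj₁ x} {inj₁ y} (inj₁ p) (inj₁ q) = inj₁ (pb-jointly-injective sq p q)
    jointly-injective {inj₂ x} {inj₂ y} (inj₂ p) (inj₂ q) = inj₂ (pb-jointly-injective sq' p q)

  pullback-× : {p₁ : Func A B} {p₂ : Func A C} {f : Func B D} {g : Func C D}
               {p₁' : Func A' B'} {p₂' : Func A' C'} {f' : Func B' D'} {g' : Func C' D'} →
               PullbackSquare p₁ p₂ f g → PullbackSquare p₁' p₂' f' g' →
               PullbackSquare (p₁ ×-function p₁') (p₂ ×-function p₂') (f ×-function f') (g ×-function g')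
  pullback-× sq sq' = record
    { pb-commutes = λ { (a , a') → pb-commutes sq a , pb-commutes sq' a' }
    ; pb-gap = λ { (e , e') → let (a , p , q) = pb-gap sq e ; (a' , p' , q') = pb-gap sq' e'
                              in (a , a') , (p , p') , (q , q') }
    ; pb-jointly-injective = λ { (p , p') (q , q') → pb-jointly-injective sq p q , pb-jointly-injective sq' p' q' } }

  -- Hence F₃ preserves pullback squares; this makes pullbacks of coalgebras componentwise.
  pullback-F₃ : {p₁ : Func A B} {p₂ : Func A C} {f : Func B D} {g : Func C D}
                {p₁' : Func A' B'} {p₂' : Func A' C'} {f' : Func B' D'} {g' : Func C' D'} →
                PullbackSquare p₁ p₂ f g → PullbackSquare p₁' p₂' f' g' →
                PullbackSquare (F₃map p₁ p₁') (F₃map p₂ p₂') (F₃map f f') (F₃map g g')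
  pullback-F₃ sq sq' = pullback-× (pullback-⊎ sq sq') (pullback-⊎ sq sq')

  module SetoidPullback {B C D : Setoid ℓ ℓ} (f : Func B D) (g : Func C D) where
    Pairs : Setoid ℓ ℓ
    Pairs = record
      { Carrier = Σ ∣ B ∣ λ b → Σ ∣ C ∣ λ c → D [ to f b ≈ to g c ]
      ; _≈_ = λ x y → B [ proj₁ x ≈ proj₁ y ] × C [ proj₁ (proj₂ x) ≈ proj₁ (proj₂ y) ]
      ; isEquivalence = record
          { refl = refl[ B ] , refl[ C ]
          ; sym = λ { (p , q) → sym[ B ] p , sym[ C ] q }
          ; trans = λ { (p , q) (p' , q') → trans[ B ] p p' , trans[ C ] q q' } } }

    π₁ : Func Pairs B
    π₁ = record { to = proj₁ ; cong = proj₁ }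

    π₂ : Func Pairs C
    π₂ = record { to = λ x → proj₁ (proj₂ x) ; cong = proj₂ }

    square : PullbackSquare π₁ π₂ f g
    square = record
      { pb-commutes = λ x → proj₂ (proj₂ x)
      ; pb-gap = λ {b} {c} e → (b , c , e) , refl[ B ] , refl[ C ]
      ; pb-jointly-injective = _,_ }

  -- Elementwise pushouts of setoids along an injection

  Identified : Func A B → Func A C → ∣ B ∣ → ∣ B ∣ → Set ℓ
  Identified {A = A} {B = B} {C = C} m f b b' =
    B [ b ≈ b' ] ⊎
    (Σ ∣ A ∣ λ a → Σ ∣ A ∣ λ a' → B [ to m a ≈ b ] × B [ to m a' ≈ b' ] × C [ to f a ≈ to f a' ])

  Glued : Func A B → Func A C → ∣ B ∣ → ∣ C ∣ → Set ℓ
  Glued {A = A} {B = B} {C = C} m f b c = Σ ∣ A ∣ λ a → B [ to m a ≈ b ] × C [ to f a ≈ c ]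

  Covered : Func B D → Func C D → ∣ D ∣ → Set ℓ
  Covered {B = B} {D = D} {C = C} g n d =
    (Σ ∣ B ∣ λ b → D [ d ≈ to g b ]) ⊎ (Σ ∣ C ∣ λ c → D [ d ≈ to n c ])

  record PushoutSquare (m : Func A B) (f : Func A C) (g : Func B D) (n : Func C D) : Set ℓ where
    field
      po-commutes : Commutes m f g n
      po-covered : ∀ d → Covered g n d
      po-n-injective : Injective n
      po-g-identifies : ∀ {b b'} → D [ to g b ≈ to g b' ] → Identified m f b b'
      po-g-meets-n : ∀ {b c} → D [ to g b ≈ to n c ] → Glued m f b c

  open PushoutSquare public

  -- Universal property: a cocone (h₁ , h₂) under the span factors through D,
  -- by choosing for each d a preimage under g or n.
  copair : {m : Func A B} {f : Func A C} {g : Func B D} {n : Func C D} →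
           PushoutSquare m f g n → (h₁ : Func B X) (h₂ : Func C X) → Commutes m f h₁ h₂ →
           Σ (Func D X) λ u → (∀ b → X [ to u (to g b) ≈ to h₁ b ]) × (∀ c → X [ to u (to n c) ≈ to h₂ c ])
  copair {C = C} {D = D} {X = X} {m = m} {f} {g} {n} sq h₁ h₂ h-commutes =
    u , (λ b → choose-cong refl[ D ] (po-covered sq (to g b)) (inj₁ (b , refl[ D ])))
      , (λ c → choose-cong refl[ D ] (po-covered sq (to n c)) (inj₂ (c , refl[ D ])))
    where
    choose : ∀ {d} → Covered g n d → ∣ X ∣
    choose (inj₁ (b , _)) = to h₁ b
    choose (inj₂ (c , _)) = to h₂ c

    glued-agree : ∀ {b c} → Glued m f b c → X [ to h₁ b ≈ to h₂ c ]
    glued-agree (a , p , q) = via[ X ] (cong h₁ p) (h-commutes a) (cong h₂ q)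

    identified-agree : ∀ {b b'} → Identified m f b b' → X [ to h₁ b ≈ to h₁ b' ]
    identified-agree (inj₁ p) = cong h₁ p
    identified-agree (inj₂ (a , a' , p , p' , q)) =
      trans[ X ] (glued-agree (a , p , q)) (sym[ X ] (glued-agree (a' , p' , refl[ C ])))

    -- the choice does not matter, by the characterisation of what D identifies
    choose-cong : ∀ {d d'} → D [ d ≈ d' ] → (s : Covered g n d) (s' : Covered g n d') →
                  X [ choose s ≈ choose s' ]
    choose-cong e (inj₁ (b , p)) (inj₁ (b' , p')) = identified-agree (po-g-identifies sq (via[ D ] p e p'))
    choose-cong e (inj₁ (b , p)) (inj₂ (c' , p')) = glued-agree (po-g-meets-n sq (via[ D ] p e p'))
    choose-cong e (inj₂ (c , p)) (inj₁ (b' , p')) =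
      sym[ X ] (glued-agree (po-g-meets-n sq (via[ D ] p' (sym[ D ] e) p)))
    choose-cong e (inj₂ (c , p)) (inj₂ (c' , p')) = cong h₂ (po-n-injective sq (via[ D ] p e p'))

    u : Func D X
    u = record { to = λ d → choose (po-covered sq d)
               ; cong = λ {d} {d'} e → choose-cong e (po-covered sq d) (po-covered sq d') }

  pushout-jointly-epic : {m : Func A B} {f : Func A C} {g : Func B D} {n : Func C D} →
                         PushoutSquare m f g n → (u u' : Func D X) →
                         (∀ b → X [ to u (to g b) ≈ to u' (to g b) ]) →
                         (∀ c → X [ to u (to n c) ≈ to u' (to n c) ]) → ∀ d → X [ to u d ≈ to u' d ]
  pushout-jointly-epic {X = X} sq u u' on-g on-n d with po-covered sq d
  ... | inj₁ (b , p) = trans[ X ] (cong u p) (trans[ X ] (on-g b) (sym[ X ] (cong u' p)))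
  ... | inj₂ (c , p) = trans[ X ] (cong u p) (trans[ X ] (on-n c) (sym[ X ] (cong u' p)))

  pushout-transport : {m : Func A B} {f : Func A C} {g : Func B D} {n : Func C D}
                      {gQ : Func B X} {nQ : Func C X} → PushoutSquare m f gQ nQ →
                      Commutes m f g n → (v : Func D X) (w : Func X D) →
                      (∀ b → X [ to v (to g b) ≈ to gQ b ]) → (∀ c → X [ to v (to n c) ≈ to nQ c ]) →
                      (∀ b → D [ to w (to gQ b) ≈ to g b ]) → (∀ c → D [ to w (to nQ c) ≈ to n c ]) →
                      (∀ d → D [ to w (to v d) ≈ d ]) → PushoutSquare m f g n
  pushout-transport {D = D} {X = X} sq sq-commutes v w v-g v-n w-g w-n wv = record
    { po-commutes = sq-commutes
    ; po-covered = λ d → [ (λ (b , p) → inj₁ (b , via[ D ] (wv d) (cong w p) (w-g b)))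
                         , (λ (c , p) → inj₂ (c , via[ D ] (wv d) (cong w p) (w-n c))) ]′
                         (po-covered sq (to v d))
    ; po-n-injective = λ {c} {c'} e → po-n-injective sq (via[ X ] (v-n c) (cong v e) (v-n c'))
    ; po-g-identifies = λ {b} {b'} e → po-g-identifies sq (via[ X ] (v-g b) (cong v e) (v-g b'))
    ; po-g-meets-n = λ {b} {c} e → po-g-meets-n sq (via[ X ] (v-g b) (cong v e) (v-n c)) }

  module SetoidPushout {A B C : Setoid ℓ ℓ} (m : Func A B) (f : Func A C) (m-injective : Injective m) where
    B⊎C : Setoid ℓ ℓ
    B⊎C = B ⊎ₛ C

    Over : ∣ B⊎C ∣ → ∣ A ∣ → Set ℓ
    Over (inj₁ b) a = B [ to m a ≈ b ]
    Over (inj₂ c) a = C [ to f a ≈ c ]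

    -- since m is injective, all points of A under x have the same f-image
    over-unique : ∀ x {a a'} → Over x a → Over x a' → C [ to f a ≈ to f a' ]
    over-unique (inj₁ b) p q = cong f (m-injective (trans[ B ] p (sym[ B ] q)))
    over-unique (inj₂ c) p q = trans[ C ] p (sym[ C ] q)

    over-resp : ∀ {x y a} → B⊎C [ x ≈ y ] → Over x a → Over y a
    over-resp (inj₁ e) p = trans[ B ] p e
    over-resp (inj₂ e) p = trans[ C ] p e

    _∼_ : ∣ B⊎C ∣ → ∣ B⊎C ∣ → Set ℓ
    x ∼ y = B⊎C [ x ≈ y ] ⊎
            (Σ ∣ A ∣ λ a → Σ ∣ A ∣ λ a' → Over x a × Over y a' × C [ to f a ≈ to f a' ])

    ∼-sym : ∀ {x y} → x ∼ y → y ∼ x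
    ∼-sym (inj₁ e) = inj₁ (sym[ B⊎C ] e)
    ∼-sym (inj₂ (a , a' , p , q , r)) = inj₂ (a' , a , q , p , sym[ C ] r)

    ∼-trans : ∀ {x y z} → x ∼ y → y ∼ z → x ∼ z
    ∼-trans (inj₁ e) (inj₁ e') = inj₁ (trans[ B⊎C ] e e')
    ∼-trans (inj₁ e) (inj₂ (a , a' , p , q , r)) = inj₂ (a , a' , over-resp (sym[ B⊎C ] e) p , q , r)
    ∼-trans (inj₂ (a , a' , p , q , r)) (inj₁ e) = inj₂ (a , a' , p , over-resp e q , r)
    ∼-trans {y = y} (inj₂ (a , a' , p , q , r)) (inj₂ (a'' , a''' , p' , q' , r')) =
      inj₂ (a , a''' , p , q' , trans[ C ] r (trans[ C ] (over-unique y q p') r'))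

    Glue : Setoid ℓ ℓ
    Glue = record
      { Carrier = ∣ B⊎C ∣
      ; _≈_ = _∼_
      ; isEquivalence = record { refl = inj₁ refl[ B⊎C ] ; sym = ∼-sym ; trans = ∼-trans } }

    ι₁ : Func B Glue
    ι₁ = record { to = inj₁ ; cong = λ p → inj₁ (inj₁ p) }

    ι₂ : Func C Glue
    ι₂ = record { to = inj₂ ; cong = λ p → inj₁ (inj₂ p) }

    square : PushoutSquare m f ι₁ ι₂
    square = record
      { po-commutes = λ a → inj₂ (a , a , refl[ B ] , refl[ C ] , refl[ C ])
      ; po-covered = λ { (inj₁ b) → inj₁ (b , inj₁ refl[ B⊎C ]) ; (inj₂ c) → inj₂ (c , inj₁ refl[ B⊎C ]) }
      ; po-n-injective = λ { (inj₁ (inj₂ p)) → p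
                           ; (inj₂ (a , a' , p , q , r)) → via[ C ] p r q }
      ; po-g-identifies = λ { (inj₁ (inj₁ p)) → inj₁ p ; (inj₂ w) → inj₂ w }
      ; po-g-meets-n = λ { (inj₁ ()) ; (inj₂ (a , a' , p , q , r)) → a , p , trans[ C ] r q } }

  -- Lifting to coalgebras

  F₃-triangle : {N₁ E₁ N₂ E₂ N₃ E₃ : Setoid ℓ ℓ}
                (gN : Func N₂ N₃) (gE : Func E₂ E₃) (fN : Func N₁ N₂) (fE : Func E₁ E₂)
                (hN : Func N₁ N₃) (hE : Func E₁ E₃) →
                (∀ x → N₃ [ to gN (to fN x) ≈ to hN x ]) → (∀ x → E₃ [ to gE (to fE x) ≈ to hE x ]) →
                ∀ x → F₃ N₃ E₃ [ to (F₃map gN gE) (to (F₃map fN fE) x) ≈ to (F₃map hN hE) x ]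
  F₃-triangle gN gE fN fE hN hE tN tE (inj₁ a , inj₁ b) = inj₁ (tN a) , inj₁ (tN b)
  F₃-triangle gN gE fN fE hN hE tN tE (inj₁ a , inj₂ b) = inj₁ (tN a) , inj₂ (tE b)
  F₃-triangle gN gE fN fE hN hE tN tE (inj₂ a , inj₁ b) = inj₂ (tE a) , inj₁ (tN b)
  F₃-triangle gN gE fN fE hN hE tN tE (inj₂ a , inj₂ b) = inj₂ (tE a) , inj₂ (tE b)

  PushoutComponents : {A B C D : Coalg ℓ} → Hom A B → Hom A C → Hom B D → Hom C D → Set ℓ
  PushoutComponents m f g n =
    PushoutSquare (fN m) (fN f) (fN g) (fN n) × PushoutSquare (fE m) (fE f) (fE g) (fE n)

  PullbackComponents : {A B C D : Coalg ℓ} → Hom A B → Hom A C → Hom B D → Hom C D → Set ℓ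
  PullbackComponents p₁ p₂ f g =
    PullbackSquare (fN p₁) (fN p₂) (fN f) (fN g) × PullbackSquare (fE p₁) (fE p₂) (fE f) (fE g)

  structure-preserved-on-image :
    {Y D X : Coalg ℓ} (k : Hom Y D) (h : Hom Y X) (uN : Func (N D) (N X)) (uE : Func (E D) (E X)) →
    (∀ y → N X [ to uN (to (fN k) y) ≈ to (fN h) y ]) → (∀ y → E X [ to uE (to (fE k) y) ≈ to (fE h) y ]) →
    ∀ {d y} → E D [ d ≈ to (fE k) y ] →
    F₃ (N X) (E X) [ to (F₃map uN uE) (to (c D) d) ≈ to (c X) (to uE d) ]
  structure-preserved-on-image {Y = Y} {D} {X} k h uN uE kN kE {d} {y} p = begin
    to (F₃map uN uE) (to (c D) d)                             ≈⟨ cong (F₃map uN uE ∘F c D) p ⟩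
    to (F₃map uN uE) (to (c D) (to (fE k) y))                 ≈⟨ cong (F₃map uN uE) (sym[ F₃ (N D) (E D) ] (comm k y)) ⟩
    to (F₃map uN uE) (to (F₃map (fN k) (fE k)) (to (c Y) y))  ≈⟨ F₃-triangle uN uE (fN k) (fE k) (fN h) (fE h) kN kE (to (c Y) y) ⟩
    to (F₃map (fN h) (fE h)) (to (c Y) y)                     ≈⟨ comm h y ⟩
    to (c X) (to (fE h) y)                                    ≈⟨ cong (c X) (sym[ E X ] (kE y)) ⟩
    to (c X) (to uE (to (fE k) y))                            ≈⟨ cong (c X ∘F uE) (sym[ E D ] p) ⟩
    to (c X) (to uE d)                                        ∎
    where open SetoidReasoning (F₃ (N X) (E X))

  -- A componentwise elementwise pushout is a pushout of coalgebras: the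
  -- componentwise copairing is a morphism because D is covered by g and n.
  componentwise-pushout : {A B C D : Coalg ℓ} (m : Hom A B) (f : Hom A C) (g : Hom B D) (n : Hom C D) →
                          PushoutComponents m f g n → IsPushout m f g n
  componentwise-pushout {A} {B} {C} {D} m f g n (sqN , sqE) =
    (po-commutes sqN , po-commutes sqE) , universal
    where
    universal : ∀ (X : Coalg ℓ) (h₁ : Hom B X) (h₂ : Hom C X) → h₁ ∘H m ≋ h₂ ∘H f →
                Σ (Hom D X) λ u → (u ∘H g ≋ h₁) × (u ∘H n ≋ h₂) ×
                  (∀ (u' : Hom D X) → u' ∘H g ≋ h₁ → u' ∘H n ≋ h₂ → u' ≋ u)
    universal X h₁ h₂ (eN , eE) = u , (uN-g , uE-g) , (uN-n , uE-n) , unique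
      where
      open Σ (copair sqN (fN h₁) (fN h₂) eN) renaming (proj₁ to uN; proj₂ to uN-factors)
      open Σ (copair sqE (fE h₁) (fE h₂) eE) renaming (proj₁ to uE; proj₂ to uE-factors)
      open Σ uN-factors renaming (proj₁ to uN-g; proj₂ to uN-n)
      open Σ uE-factors renaming (proj₁ to uE-g; proj₂ to uE-n)

      u : Hom D X
      u = record
        { fN = uN
        ; fE = uE
        ; comm = λ d → [ (λ (b , p) → structure-preserved-on-image g h₁ uN uE uN-g uE-g p)
                       , (λ (c , p) → structure-preserved-on-image n h₂ uN uE uN-n uE-n p) ]′
                       (po-covered sqE d) }

      unique : ∀ (u' : Hom D X) → u' ∘H g ≋ h₁ → u' ∘H n ≋ h₂ → u' ≋ u
      unique u' (gN , gE) (nN , nE) =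
        pushout-jointly-epic sqN (fN u') uN (λ b → trans[ N X ] (gN b) (sym[ N X ] (uN-g b)))
                                            (λ c → trans[ N X ] (nN c) (sym[ N X ] (uN-n c))) ,
        pushout-jointly-epic sqE (fE u') uE (λ b → trans[ E X ] (gE b) (sym[ E X ] (uE-g b)))
                                            (λ c → trans[ E X ] (nE c) (sym[ E X ] (uE-n c)))

  -- A componentwise elementwise pullback is a pullback of coalgebras: the
  -- componentwise pairing is a morphism because F₃ preserves pullbacks.
  componentwise-pullback : {A B C D : Coalg ℓ} (p₁ : Hom A B) (p₂ : Hom A C) (f : Hom B D) (g : Hom C D) →
                           PullbackComponents p₁ p₂ f g → IsPullback p₁ p₂ f g
  componentwise-pullback {A} {B} {C} {D} p₁ p₂ f g (sqN , sqE) =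
    (pb-commutes sqN , pb-commutes sqE) , universal
    where
    universal : ∀ (X : Coalg ℓ) (h₁ : Hom X B) (h₂ : Hom X C) → f ∘H h₁ ≋ g ∘H h₂ →
                Σ (Hom X A) λ u → (p₁ ∘H u ≋ h₁) × (p₂ ∘H u ≋ h₂) ×
                  (∀ (u' : Hom X A) → p₁ ∘H u' ≋ h₁ → p₂ ∘H u' ≋ h₂ → u' ≋ u)
    universal X h₁ h₂ (eN , eE) = u , (p₁-uN , p₁-uE) , (p₂-uN , p₂-uE) , unique
      where
      open Σ (pair sqN (fN h₁) (fN h₂) eN) renaming (proj₁ to uN; proj₂ to uN-factors)
      open Σ (pair sqE (fE h₁) (fE h₂) eE) renaming (proj₁ to uE; proj₂ to uE-factors)
      open Σ uN-factors renaming (proj₁ to p₁-uN; proj₂ to p₂-uN)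
      open Σ uE-factors renaming (proj₁ to p₁-uE; proj₂ to p₂-uE)

      agree-after : {Y : Coalg ℓ} (p : Hom A Y) (h : Hom X Y) →
                    (∀ x → N Y [ to (fN p) (to uN x) ≈ to (fN h) x ]) →
                    (∀ x → E Y [ to (fE p) (to uE x) ≈ to (fE h) x ]) → ∀ x →
                    F₃ (N Y) (E Y) [ to (F₃map (fN p) (fE p)) (to (F₃map uN uE) (to (c X) x))
                                   ≈ to (F₃map (fN p) (fE p)) (to (c A) (to uE x)) ]
      agree-after {Y} p h pN pE x = begin
        to (F₃map (fN p) (fE p)) (to (F₃map uN uE) (to (c X) x))  ≈⟨ F₃-triangle (fN p) (fE p) uN uE (fN h) (fE h) pN pE (to (c X) x) ⟩
        to (F₃map (fN h) (fE h)) (to (c X) x)                     ≈⟨ comm h x ⟩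
        to (c Y) (to (fE h) x)                                    ≈⟨ cong (c Y) (sym[ E Y ] (pE x)) ⟩
        to (c Y) (to (fE p) (to uE x))                            ≈⟨ sym[ F₃ (N Y) (E Y) ] (comm p (to uE x)) ⟩
        to (F₃map (fN p) (fE p)) (to (c A) (to uE x))             ∎
        where open SetoidReasoning (F₃ (N Y) (E Y))

      u : Hom X A
      u = record
        { fN = uN
        ; fE = uE
        ; comm = λ x → pb-jointly-injective (pullback-F₃ sqN sqE)
                         (agree-after p₁ h₁ p₁-uN p₁-uE x) (agree-after p₂ h₂ p₂-uN p₂-uE x) }

      unique : ∀ (u' : Hom X A) → p₁ ∘H u' ≋ h₁ → p₂ ∘H u' ≋ h₂ → u' ≋ u
      unique u' (q₁N , q₁E) (q₂N , q₂E) =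
        (λ x → pb-jointly-injective sqN (trans[ N B ] (q₁N x) (sym[ N B ] (p₁-uN x)))
                                        (trans[ N C ] (q₂N x) (sym[ N C ] (p₂-uN x)))) ,
        (λ x → pb-jointly-injective sqE (trans[ E B ] (q₁E x) (sym[ E B ] (p₁-uE x)))
                                        (trans[ E C ] (q₂E x) (sym[ E C ] (p₂-uE x))))

  -- Pushouts along M exist: glue nodes and edges separately; the structure map
  -- of the glued coalgebra is the copairing of those of B and C.
  module CoalgPushout {A B C : Coalg ℓ} (m : Hom A B) (f : Hom A C) (m-in-M : M m) where
    module Nodes = SetoidPushout (fN m) (fN f) (proj₁ m-in-M)
    module Edges = SetoidPushout (fE m) (fE f) (proj₂ m-in-M)

    FQ : Setoid ℓ ℓ
    FQ = F₃ Nodes.Glue Edges.Glue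

    structure-cocone : Commutes (fE m) (fE f) (F₃map Nodes.ι₁ Edges.ι₁ ∘F c B) (F₃map Nodes.ι₂ Edges.ι₂ ∘F c C)
    structure-cocone a = begin
      to (F₃map Nodes.ι₁ Edges.ι₁) (to (c B) (to (fE m) a))
        ≈⟨ cong (F₃map Nodes.ι₁ Edges.ι₁) (sym[ F₃ (N B) (E B) ] (comm m a)) ⟩
      to (F₃map Nodes.ι₁ Edges.ι₁) (to (F₃map (fN m) (fE m)) (to (c A) a))
        ≈⟨ F₃-triangle Nodes.ι₁ Edges.ι₁ (fN m) (fE m) (Nodes.ι₂ ∘F fN f) (Edges.ι₂ ∘F fE f)
                       (po-commutes Nodes.square) (po-commutes Edges.square) (to (c A) a) ⟩
      to (F₃map (Nodes.ι₂ ∘F fN f) (Edges.ι₂ ∘F fE f)) (to (c A) a)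
        ≈⟨ sym[ FQ ] (F₃-triangle Nodes.ι₂ Edges.ι₂ (fN f) (fE f) (Nodes.ι₂ ∘F fN f) (Edges.ι₂ ∘F fE f)
                                  (λ _ → refl[ Nodes.Glue ]) (λ _ → refl[ Edges.Glue ]) (to (c A) a)) ⟩
      to (F₃map Nodes.ι₂ Edges.ι₂) (to (F₃map (fN f) (fE f)) (to (c A) a))
        ≈⟨ cong (F₃map Nodes.ι₂ Edges.ι₂) (comm f a) ⟩
      to (F₃map Nodes.ι₂ Edges.ι₂) (to (c C) (to (fE f) a))
        ∎
      where open SetoidReasoning FQ

    structure : Σ (Func Edges.Glue FQ) λ u →
                  (∀ b → FQ [ to u (to Edges.ι₁ b) ≈ to (F₃map Nodes.ι₁ Edges.ι₁) (to (c B) b) ]) ×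
                  (∀ x → FQ [ to u (to Edges.ι₂ x) ≈ to (F₃map Nodes.ι₂ Edges.ι₂) (to (c C) x) ])
    structure = copair Edges.square (F₃map Nodes.ι₁ Edges.ι₁ ∘F c B) (F₃map Nodes.ι₂ Edges.ι₂ ∘F c C) structure-cocone

    Q : Coalg ℓ
    Q = record { N = Nodes.Glue ; E = Edges.Glue ; c = proj₁ structure }

    inl : Hom B Q
    inl = record { fN = Nodes.ι₁ ; fE = Edges.ι₁ ; comm = λ b → sym[ FQ ] (proj₁ (proj₂ structure) b) }

    inr : Hom C Q
    inr = record { fN = Nodes.ι₂ ; fE = Edges.ι₂ ; comm = λ x → sym[ FQ ] (proj₂ (proj₂ structure) x) }

    is-pushout : IsPushout m f inl inr
    is-pushout = componentwise-pushout m f inl inr (Nodes.square , Edges.square)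

  -- Pullbacks exist: pair nodes and edges separately; the structure map of the
  -- paired coalgebra is the pairing of those of B and C in the pullback F₃-square.
  module CoalgPullback {B C D : Coalg ℓ} (f : Hom B D) (g : Hom C D) where
    module Nodes = SetoidPullback (fN f) (fN g)
    module Edges = SetoidPullback (fE f) (fE g)

    structure-cone : Commutes (c B ∘F Edges.π₁) (c C ∘F Edges.π₂) (F₃map (fN f) (fE f)) (F₃map (fN g) (fE g))
    structure-cone (b , x , e) =
      trans[ FD ] (comm f b) (trans[ FD ] (cong (c D) e) (sym[ FD ] (comm g x)))
      where FD = F₃ (N D) (E D)

    structure : Σ (Func Edges.Pairs (F₃ Nodes.Pairs Edges.Pairs)) λ u →
                  (∀ x → F₃ (N B) (E B) [ to (F₃map Nodes.π₁ Edges.π₁) (to u x) ≈ to (c B) (to Edges.π₁ x) ]) ×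
                  (∀ x → F₃ (N C) (E C) [ to (F₃map Nodes.π₂ Edges.π₂) (to u x) ≈ to (c C) (to Edges.π₂ x) ])
    structure = pair (pullback-F₃ Nodes.square Edges.square) (c B ∘F Edges.π₁) (c C ∘F Edges.π₂) structure-cone

    P : Coalg ℓ
    P = record { N = Nodes.Pairs ; E = Edges.Pairs ; c = proj₁ structure }

    outl : Hom P B
    outl = record { fN = Nodes.π₁ ; fE = Edges.π₁ ; comm = proj₁ (proj₂ structure) }

    outr : Hom P C
    outr = record { fN = Nodes.π₂ ; fE = Edges.π₂ ; comm = proj₂ (proj₂ structure) }

    is-pullback : IsPullback outl outr f g
    is-pullback = componentwise-pullback outl outr f g (Nodes.square , Edges.square)

  -- Every pushout along M and every pullback is componentwise elementwise

  module PushoutMediator {A B C D : Coalg ℓ} {m : Hom A B} {f : Hom A C} {g : Hom B D} {n : Hom C D}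
                         (po : IsPushout m f g n) {X : Coalg ℓ} (h₁ : Hom B X) (h₂ : Hom C X)
                         (h-commutes : h₁ ∘H m ≋ h₂ ∘H f) where
    mediator : Hom D X
    mediator = proj₁ (proj₂ po X h₁ h₂ h-commutes)

    mediator-g : mediator ∘H g ≋ h₁
    mediator-g = proj₁ (proj₂ (proj₂ po X h₁ h₂ h-commutes))

    mediator-n : mediator ∘H n ≋ h₂
    mediator-n = proj₁ (proj₂ (proj₂ (proj₂ po X h₁ h₂ h-commutes)))

    mediator-unique : ∀ (u : Hom D X) → u ∘H g ≋ h₁ → u ∘H n ≋ h₂ → u ≋ mediator
    mediator-unique = proj₂ (proj₂ (proj₂ (proj₂ po X h₁ h₂ h-commutes)))

    mediators-agree : ∀ (u u' : Hom D X) → u ∘H g ≋ h₁ → u ∘H n ≋ h₂ → u' ∘H g ≋ h₁ → u' ∘H n ≋ h₂ → u ≋ u'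
    mediators-agree u u' u-g u-n u'-g u'-n =
      (λ x → trans[ N X ] (proj₁ (mediator-unique u u-g u-n) x) (sym[ N X ] (proj₁ (mediator-unique u' u'-g u'-n) x))) ,
      (λ x → trans[ E X ] (proj₂ (mediator-unique u u-g u-n) x) (sym[ E X ] (proj₂ (mediator-unique u' u'-g u'-n) x)))

  module PullbackMediator {A B C D : Coalg ℓ} {p₁ : Hom A B} {p₂ : Hom A C} {f : Hom B D} {g : Hom C D}
                          (pb : IsPullback p₁ p₂ f g) {X : Coalg ℓ} (h₁ : Hom X B) (h₂ : Hom X C)
                          (h-commutes : f ∘H h₁ ≋ g ∘H h₂) where
    mediator : Hom X A
    mediator = proj₁ (proj₂ pb X h₁ h₂ h-commutes)

    mediator-p₁ : p₁ ∘H mediator ≋ h₁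
    mediator-p₁ = proj₁ (proj₂ (proj₂ pb X h₁ h₂ h-commutes))

    mediator-p₂ : p₂ ∘H mediator ≋ h₂
    mediator-p₂ = proj₁ (proj₂ (proj₂ (proj₂ pb X h₁ h₂ h-commutes)))

    mediator-unique : ∀ (u : Hom X A) → p₁ ∘H u ≋ h₁ → p₂ ∘H u ≋ h₂ → u ≋ mediator
    mediator-unique = proj₂ (proj₂ (proj₂ (proj₂ pb X h₁ h₂ h-commutes)))

    mediators-agree : ∀ (u u' : Hom X A) → p₁ ∘H u ≋ h₁ → p₂ ∘H u ≋ h₂ → p₁ ∘H u' ≋ h₁ → p₂ ∘H u' ≋ h₂ → u ≋ u'
    mediators-agree u u' u-p₁ u-p₂ u'-p₁ u'-p₂ =
      (λ x → trans[ N A ] (proj₁ (mediator-unique u u-p₁ u-p₂) x) (sym[ N A ] (proj₁ (mediator-unique u' u'-p₁ u'-p₂) x))) ,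
      (λ x → trans[ E A ] (proj₂ (mediator-unique u u-p₁ u-p₂) x) (sym[ E A ] (proj₂ (mediator-unique u' u'-p₁ u'-p₂) x)))

  pushout-endo-id : {A B C D : Coalg ℓ} {m : Hom A B} {f : Hom A C} {g : Hom B D} {n : Hom C D} →
                    IsPushout m f g n → (u : Hom D D) → u ∘H g ≋ g → u ∘H n ≋ n → u ≋ idH D
  pushout-endo-id {m = m} {f} {g} {n} po u u-g u-n =
    mediators-agree u (idH _) u-g u-n (≋-id-left g) (≋-id-left n)
    where
    open PushoutMediator {m = m} {f = f} {g = g} {n = n} po g n (proj₁ po)
    ≋-id-left : {X Y : Coalg _} (h : Hom X Y) → idH Y ∘H h ≋ h
    ≋-id-left {Y = Y} h = (λ _ → refl[ N Y ]) , (λ _ → refl[ E Y ])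

  pullback-endo-id : {A B C D : Coalg ℓ} {p₁ : Hom A B} {p₂ : Hom A C} {f : Hom B D} {g : Hom C D} →
                     IsPullback p₁ p₂ f g → (u : Hom A A) → p₁ ∘H u ≋ p₁ → p₂ ∘H u ≋ p₂ → u ≋ idH A
  pullback-endo-id {p₁ = p₁} {p₂} {f} {g} pb u p₁-u p₂-u =
    mediators-agree u (idH _) p₁-u p₂-u (≋-id-right p₁) (≋-id-right p₂)
    where
    open PullbackMediator {p₁ = p₁} {p₂ = p₂} {f = f} {g = g} pb p₁ p₂ (proj₁ pb)
    ≋-id-right : {X Y : Coalg _} (h : Hom X Y) → h ∘H idH X ≋ h
    ≋-id-right {Y = Y} h = (λ _ → refl[ N Y ]) , (λ _ → refl[ E Y ])

  triangles-under : {B D Q R : Coalg ℓ} (g : Hom B D) (g' : Hom B Q) (g'' : Hom B R)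
                    (v : Hom D Q) (w : Hom Q R) → v ∘H g ≋ g' → w ∘H g' ≋ g'' → (w ∘H v) ∘H g ≋ g''
  triangles-under {R = R} g g' g'' v w (vN , vE) (wN , wE) =
    (λ b → trans[ N R ] (cong (fN w) (vN b)) (wN b)) , (λ b → trans[ E R ] (cong (fE w) (vE b)) (wE b))

  triangles-over : {A B P R : Coalg ℓ} (p : Hom A B) (q : Hom P B) (p' : Hom R B)
                   (u : Hom P A) (k : Hom R P) → p ∘H u ≋ q → q ∘H k ≋ p' → p ∘H (u ∘H k) ≋ p'
  triangles-over {B = B} p q p' u k (uN , uE) (kN , kE) =
    (λ x → trans[ N B ] (uN (to (fN k) x)) (kN x)) , (λ x → trans[ E B ] (uE (to (fE k) x)) (kE x))

  -- Every pushout along M is componentwise elementwise: D is a retract of the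
  -- constructed pushout Q, compatibly with the injections.
  pushout-componentwise : {A B C D : Coalg ℓ} (m : Hom A B) (f : Hom A C) (g : Hom B D) (n : Hom C D) →
                          M m → IsPushout m f g n → PushoutComponents m f g n
  pushout-componentwise {D = D} m f g n m-in-M po =
    pushout-transport Nodes.square (proj₁ (proj₁ po)) (fN to-Q) (fN from-Q)
      (proj₁ to-Q-g) (proj₁ to-Q-n) (proj₁ from-Q-g) (proj₁ from-Q-n) (proj₁ retract) ,
    pushout-transport Edges.square (proj₂ (proj₁ po)) (fE to-Q) (fE from-Q)
      (proj₂ to-Q-g) (proj₂ to-Q-n) (proj₂ from-Q-g) (proj₂ from-Q-n) (proj₂ retract)
    where
    open CoalgPushout m f m-in-M
    open PushoutMediator {m = m} {f = f} {g = g} {n = n} po inl inr (proj₁ is-pushout) using ()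
      renaming (mediator to to-Q; mediator-g to to-Q-g; mediator-n to to-Q-n)
    open PushoutMediator {m = m} {f = f} {g = inl} {n = inr} is-pushout g n (proj₁ po) using ()
      renaming (mediator to from-Q; mediator-g to from-Q-g; mediator-n to from-Q-n)

    retract : from-Q ∘H to-Q ≋ idH D
    retract = pushout-endo-id {m = m} {f = f} {g = g} {n = n} po (from-Q ∘H to-Q)
      (triangles-under g inl g to-Q from-Q to-Q-g from-Q-g) (triangles-under n inr n to-Q from-Q to-Q-n from-Q-n)

  -- Every pullback is componentwise elementwise: A is a retract of the
  -- constructed pullback P, compatibly with the projections.
  pullback-componentwise : {A B C D : Coalg ℓ} (p₁ : Hom A B) (p₂ : Hom A C) (f : Hom B D) (g : Hom C D) →
                           IsPullback p₁ p₂ f g → PullbackComponents p₁ p₂ f g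
  pullback-componentwise {A = A} p₁ p₂ f g pb =
    pullback-transport Nodes.square (proj₁ (proj₁ pb)) (fN from-P) (fN to-P)
      (proj₁ from-P-p₁) (proj₁ from-P-p₂) (proj₁ to-P-p₁) (proj₁ to-P-p₂) (proj₁ retract) ,
    pullback-transport Edges.square (proj₂ (proj₁ pb)) (fE from-P) (fE to-P)
      (proj₂ from-P-p₁) (proj₂ from-P-p₂) (proj₂ to-P-p₁) (proj₂ to-P-p₂) (proj₂ retract)
    where
    open CoalgPullback f g
    open PullbackMediator {p₁ = p₁} {p₂ = p₂} {f = f} {g = g} pb outl outr (proj₁ is-pullback) using ()
      renaming (mediator to from-P; mediator-p₁ to from-P-p₁; mediator-p₂ to from-P-p₂)
    open PullbackMediator {p₁ = outl} {p₂ = outr} {f = f} {g = g} is-pullback p₁ p₂ (proj₁ pb) using ()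
      renaming (mediator to to-P; mediator-p₁ to to-P-p₁; mediator-p₂ to to-P-p₂)

    retract : from-P ∘H to-P ≋ idH A
    retract = pullback-endo-id {p₁ = p₁} {p₂ = p₂} {f = f} {g = g} pb (from-P ∘H to-P)
      (triangles-over p₁ outl p₁ from-P to-P from-P-p₁ to-P-p₁) (triangles-over p₂ outr p₂ from-P to-P from-P-p₂ to-P-p₂)

  -- The van Kampen property for a cube of setoids

  module SetoidCube {A B C D A' B' C' D' : Setoid ℓ ℓ}
    {m : Func A B} {f : Func A C} {g : Func B D} {n : Func C D}
    {m' : Func A' B'} {f' : Func A' C'} {g' : Func B' D'} {n' : Func C' D'}
    {a : Func A' A} {b : Func B' B} {cc : Func C' C} {d : Func D' D}
    (top : Commutes m' f' g' n')
    (back-left : Commutes a m' m b) (back-right : Commutes a f' f cc)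
    (front-left : Commutes b g' g d) (front-right : Commutes cc n' n d)
    (b-injective : Injective b) (cc-injective : Injective cc)
    (bottom : PushoutSquare m f g n)
    (back-left-pb : PullbackSquare m' a b m) (back-right-pb : PullbackSquare f' a cc f) where

    lift-left : ∀ {a₀ y} → B [ to m a₀ ≈ to b y ] → Σ ∣ A' ∣ λ x → B' [ to m' x ≈ y ] × A [ to a x ≈ a₀ ]
    lift-left e = pb-gap back-left-pb (sym[ B ] e)

    lift-right : ∀ {a₀ z} → C [ to f a₀ ≈ to cc z ] → Σ ∣ A' ∣ λ x → C' [ to f' x ≈ z ] × A [ to a x ≈ a₀ ]
    lift-right e = pb-gap back-right-pb (sym[ C ] e)

    over-m : ∀ {x a₀} → A [ to a x ≈ a₀ ] → B [ to b (to m' x) ≈ to m a₀ ]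
    over-m {x} p = trans[ B ] (sym[ B ] (back-left x)) (cong m p)

    over-f : ∀ {x a₀} → A [ to a x ≈ a₀ ] → C [ to cc (to f' x) ≈ to f a₀ ]
    over-f {x} p = trans[ C ] (sym[ C ] (back-right x)) (cong f p)

    top-via : ∀ {x z} → C' [ to f' x ≈ z ] → D' [ to g' (to m' x) ≈ to n' z ]
    top-via {x} p = trans[ D' ] (top x) (cong n' p)

    glued-lifts : ∀ {b₀ z} → Glued m f b₀ (to cc z) →
                  Σ ∣ A' ∣ λ x → B [ to b (to m' x) ≈ b₀ ] × C' [ to f' x ≈ z ]
    glued-lifts (a₀ , p , q) = let (x , r , s) = lift-right q in x , trans[ B ] (over-m s) p , r

    n'-injective : Injective n'
    n'-injective {c₁} {c₂} e =
      cc-injective (po-n-injective bottom (trans[ D ] (front-right c₁) (trans[ D ] (cong d e) (sym[ D ] (front-right c₂)))))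

    -- Top pushout ⇒ front faces are pullbacks: cover d₀ by the top pushout
    -- and lift the bottom identification along the back pullbacks.
    module _ (top-po : PushoutSquare m' f' g' n') where
      front-left-gap : ∀ {d₀ b₀} → D [ to d d₀ ≈ to g b₀ ] →
                       Σ ∣ B' ∣ λ y → D' [ to g' y ≈ d₀ ] × B [ to b y ≈ b₀ ]
      front-left-gap {d₀} e with po-covered top-po d₀
      ... | inj₂ (c₁ , p) =
        let (x , u , v) = glued-lifts (po-g-meets-n bottom (via[ D ] e (cong d p) (sym[ D ] (front-right c₁))))
        in to m' x , trans[ D' ] (top-via v) (sym[ D' ] p) , u
      ... | inj₁ (b₁ , p) with po-g-identifies bottom (via[ D ] e (cong d p) (sym[ D ] (front-left b₁)))
      ...   | inj₁ q = b₁ , sym[ D' ] p , sym[ B ] q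
      ...   | inj₂ (a₀ , a₁ , q₀ , q₁ , r) =
        let (x₁ , s₁ , t₁) = lift-left q₁
            (x , u , v) = glued-lifts (a₀ , q₀ , trans[ C ] r (sym[ C ] (over-f t₁)))
        in to m' x , trans[ D' ] (top-via v) (via[ D' ] (top x₁) (cong g' s₁) (sym[ D' ] p)) , u

      front-right-gap : ∀ {d₀ c₀} → D [ to d d₀ ≈ to n c₀ ] →
                        Σ ∣ C' ∣ λ z → D' [ to n' z ≈ d₀ ] × C [ to cc z ≈ c₀ ]
      front-right-gap {d₀} e with po-covered top-po d₀
      ... | inj₁ (b₁ , p) =
        let (a₀ , q , r) = po-g-meets-n bottom (trans[ D ] (front-left b₁) (trans[ D ] (cong d (sym[ D' ] p)) e))
            (x , s , t) = lift-left q
        in to f' x , via[ D' ] (top x) (cong g' s) (sym[ D' ] p) , trans[ C ] (over-f t) r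
      ... | inj₂ (c₁ , p) =
        c₁ , sym[ D' ] p , po-n-injective bottom (trans[ D ] (front-right c₁) (trans[ D ] (cong d (sym[ D' ] p)) e))

      front-pullbacks : PullbackSquare g' b d g × PullbackSquare n' cc d n
      front-pullbacks =
        record { pb-commutes = λ y → sym[ D ] (front-left y) ; pb-gap = front-left-gap
               ; pb-jointly-injective = λ _ q → b-injective q } ,
        record { pb-commutes = λ z → sym[ D ] (front-right z) ; pb-gap = front-right-gap
               ; pb-jointly-injective = λ _ q → cc-injective q }

    -- Front faces pullbacks ⇒ top pushout: covering comes from the front
    -- pullbacks, the identifications from the bottom and the back pullbacks.
    top-pushout : PullbackSquare g' b d g → PullbackSquare n' cc d n → PushoutSquare m' f' g' n'
    top-pushout front-left-pb front-right-pb = record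
      { po-commutes = top
      ; po-covered = covered
      ; po-n-injective = n'-injective
      ; po-g-identifies = identifies
      ; po-g-meets-n = meets }
      where
      covered : ∀ d₀ → Covered g' n' d₀
      covered d₀ =
        [ (λ (_ , p) → let (y , q , _) = pb-gap front-left-pb p in inj₁ (y , sym[ D' ] q))
        , (λ (_ , p) → let (z , q , _) = pb-gap front-right-pb p in inj₂ (z , sym[ D' ] q)) ]′
        (po-covered bottom (to d d₀))

      bottom-of : ∀ {y y'} → D' [ to g' y ≈ y' ] → ∀ {t} → D [ to d y' ≈ t ] → D [ to g (to b y) ≈ t ]
      bottom-of {y} e q = trans[ D ] (front-left y) (trans[ D ] (cong d e) q)

      identifies : ∀ {b₁ b₂} → D' [ to g' b₁ ≈ to g' b₂ ] → Identified m' f' b₁ b₂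
      identifies {b₁} {b₂} e with po-g-identifies bottom (bottom-of e (sym[ D ] (front-left b₂)))
      ... | inj₁ q = inj₁ (b-injective q)
      ... | inj₂ (a₁ , a₂ , q₁ , q₂ , _) =
        let (x₁ , r₁ , _) = lift-left q₁
            (x₂ , r₂ , _) = lift-left q₂
        in inj₂ (x₁ , x₂ , r₁ , r₂ ,
                 n'-injective (via[ D' ] (top x₁) (trans[ D' ] (cong g' r₁) (trans[ D' ] e (sym[ D' ] (cong g' r₂)))) (top x₂)))

      meets : ∀ {b₁ c₁} → D' [ to g' b₁ ≈ to n' c₁ ] → Glued m' f' b₁ c₁
      meets {b₁} {c₁} e =
        let (a₀ , q , _) = po-g-meets-n bottom (bottom-of e (sym[ D ] (front-right c₁)))
            (x , r , _) = lift-left q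
        in x , r , n'-injective (via[ D' ] (top x) (cong g' r) e)

  -- The M-adhesivity axioms

  M-monic : {X Y : Coalg ℓ} (h : Hom X Y) → M h → Mono h
  M-monic h (hN , hE) _ _ _ (eN , eE) = (λ x → hN (eN x)) , (λ x → hE (eE x))

  M-identity : (X : Coalg ℓ) → M (idH X)
  M-identity X = (λ p → p) , (λ p → p)

  M-composition : {X Y Z : Coalg ℓ} (h : Hom Y Z) (k : Hom X Y) → M k → M h → M (h ∘H k)
  M-composition h k (kN , kE) (hN , hE) = (λ p → kN (hN p)) , (λ p → kE (hE p))

  pushout-preserves-M : {A B C D : Coalg ℓ} (m : Hom A B) (f : Hom A C) (g : Hom B D) (n : Hom C D) →
                        M m → IsPushout m f g n → M n
  pushout-preserves-M m f g n m-in-M po =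
    let (sqN , sqE) = pushout-componentwise m f g n m-in-M po in po-n-injective sqN , po-n-injective sqE

  pullback-preserves-M : {A B C D : Coalg ℓ} (p₁ : Hom A B) (p₂ : Hom A C) (g : Hom B D) (n : Hom C D) →
                         M n → IsPullback p₁ p₂ g n → M p₁
  pullback-preserves-M p₁ p₂ g n (nN , nE) pb =
    let (sqN , sqE) = pullback-componentwise p₁ p₂ g n pb
    in pullback-reflects-injective sqN nN , pullback-reflects-injective sqE nE

  -- Pushouts along M are vertical weak van Kampen squares: apply the setoid cube
  -- to both components, passing between (co)limits and their elementwise form.
  pushout-along-M-is-van-Kampen : {A B C D : Coalg ℓ} (m : Hom A B) (f : Hom A C) (g : Hom B D) (n : Hom C D) →
                                  M m → IsPushout m f g n → VerticalWeakVK m f g n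
  pushout-along-M-is-van-Kampen m f g n m-in-M po A' B' C' D' m' f' g' n' a b cc d
    top back-left back-right front-left front-right _ b-in-M cc-in-M _ back-left-pb back-right-pb =
    front-faces-pullbacks , top-face-pushout
    where
    bottom : PushoutComponents m f g n
    bottom = pushout-componentwise m f g n m-in-M po

    back-left-sq : PullbackComponents m' a b m
    back-left-sq = pullback-componentwise m' a b m back-left-pb

    back-right-sq : PullbackComponents f' a cc f
    back-right-sq = pullback-componentwise f' a cc f back-right-pb

    module Nodes = SetoidCube {g' = fN g'} {n' = fN n'} {d = fN d}
                     (proj₁ top) (proj₁ back-left) (proj₁ back-right) (proj₁ front-left) (proj₁ front-right)
                     (proj₁ b-in-M) (proj₁ cc-in-M) (proj₁ bottom) (proj₁ back-left-sq) (proj₁ back-right-sq)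
    module Edges = SetoidCube {g' = fE g'} {n' = fE n'} {d = fE d}
                     (proj₂ top) (proj₂ back-left) (proj₂ back-right) (proj₂ front-left) (proj₂ front-right)
                     (proj₂ b-in-M) (proj₂ cc-in-M) (proj₂ bottom) (proj₂ back-left-sq) (proj₂ back-right-sq)

    -- the top pushout is along m' ∈ M, as M is stable under the back-left pullback
    front-faces-pullbacks : IsPushout m' f' g' n' → IsPullback g' b d g × IsPullback n' cc d n
    front-faces-pullbacks top-po =
      let (topN , topE) = pushout-componentwise m' f' g' n' (pullback-preserves-M m' a b m m-in-M back-left-pb) top-po
          (leftN , rightN) = Nodes.front-pullbacks topN
          (leftE , rightE) = Edges.front-pullbacks topE
      in componentwise-pullback g' b d g (leftN , leftE) , componentwise-pullback n' cc d n (rightN , rightE)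

    top-face-pushout : IsPullback g' b d g × IsPullback n' cc d n → IsPushout m' f' g' n'
    top-face-pushout (left-pb , right-pb) =
      let (leftN , leftE) = pullback-componentwise g' b d g left-pb
          (rightN , rightE) = pullback-componentwise n' cc d n right-pb
      in componentwise-pushout m' f' g' n' (Nodes.top-pushout leftN rightN , Edges.top-pushout leftE rightE)

corollary5 : (ℓ : Level) → IsMAdhesive ℓ
corollary5 ℓ = record
  { M-mono = M-monic
  ; M-id = M-identity
  ; M-comp = M-composition
  ; pushout = λ m f m-in-M → let open CoalgPushout m f m-in-M in Q , inl , inr , is-pushout
  ; pullback = λ g n _ → let open CoalgPullback g n in P , outl , outr , is-pullback
  ; M-pushout-stable = pushout-preserves-M
  ; M-pullback-stable = pullback-preserves-M
  ; vanKampen = pushout-along-M-is-van-Kampen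
  }
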